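{- For $R=J(f^{op})$, where $f^{op}\colon n\rightarrow m$ is an arrow of $\mathbf{Set}_\omega^{op}$, and for $\overrightarrow{ab}=a_0\ldots a_{n-1}b_0\ldots b_{m-1}$ a sequence appropriate for $R$, the relation $F_{\overrightarrow{ab}}(R)$ is a function from $a_0\cdot\ldots\cdot a_{n-1}$ to $b_0\cdot\ldots\cdot b_{m-1}$.
   Context: $\mathbf{Set}_\omega$ is the full subcategory of $\mathbf{Set}$ whose objects are the finite ordinals $0,1,2,\ldots$ (with $n=\{0,\ldots,n-1\}$), and $\mathbf{Set}_\omega^{op}$ is its opposite category; an arrow $f^{op}\colon n\rightarrow m$ of $\mathbf{Set}_\omega^{op}$ corresponds to a function $f\colon m\rightarrow n$. $\mathit{Gen}$ is the category whose objects are the finite ordinals and whose arrows $R\colon n\rightarrow m$ are arbitrary equivalence relations on the ordinal $n+m$ (split equivalences). $J\colon \mathbf{Set}_\omega^{op}\rightarrow \mathit{Gen}$ is the identity-on-objects functor sending $f^{op}\colon n\rightarrow m$ to the equivalence relation on $n+m$ whose $n$ equivalence classes are, for each $i\in n$, the sets $\{i\}\cup\{j+n\mid j\in m,\ f(j)=i\}$. For a sequence $\overrightarrow{d}=d_0\ldots d_{k-1}$ of finite ordinals, $\iota_{\overrightarrow{d}}\colon d_0\times\ldots\times d_{k-1}\rightarrow d_0\cdot\ldots\cdot d_{k-1}$ is the bijection $\iota_{\overrightarrow{d}}(i_0,\ldots,i_{k-1})=i_0\cdot d_1\cdot\ldots\cdot d_{k-1}+\ldots+i_{k-2}\cdot d_{k-1}+i_{k-1}$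 (position in lexicographic order). For an arrow $R\colon n\rightarrow m$ of $\mathit{Gen}$ and a sequence $\overrightarrow{ab}=a_0\ldots a_{n-1}b_0\ldots b_{m-1}$ of finite ordinals each $\geq 2$, $F_{\overrightarrow{ab}}(R)$ is the set of pairs $(i,j)\in(a_0\cdot\ldots\cdot a_{n-1})\times(b_0\cdot\ldots\cdot b_{m-1})$ such that, letting $\overrightarrow{c}$ be the $(n+m)$-tuple obtained by concatenating $\iota_{\overrightarrow{a}}^{ -1}(i)$ and $\iota_{\overrightarrow{b}}^{ -1}(j)$, for all $x,y\in n+m$, $(x,y)\in R$ implies $\pi_x(\overrightarrow{c})=\pi_y(\overrightarrow{c})$ (where $\pi_x$ is the $x$-th projection). The sequence $\overrightarrow{ab}$ is appropriate for $R$ when any two positions of $n+m$ related by $R$ carry equal entries of the sequence $a_0\ldots a_{n-1}b_0\ldots b_{m-1}$ (i.e. $a_i=a_j$ for related source positions, $a_i=b_{j}$ for a related source position $i$ and target position $n+j$, and $b_i=b_j$ for related target positions $n+i$, $n+j$). -}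

module Defs where

open import Data.Nat using (ℕ; zero; suc; _*_; _+_)
open import Data.Fin using (Fin; zero; suc; toℕ; combine; splitAt; remQuot)
open import Data.Sum using ([_,_])
open import Data.Product using (proj₁; proj₂)
open import Function using (id; _∘_)
open import Relation.Binary.PropositionalEquality using (_≡_)

prod : ∀ {k} → (Fin k → ℕ) → ℕ
prod {zero}  d = 1
prod {suc k} d = d zero * prod (d ∘ suc)

Tuple : ∀ {k} → (Fin k → ℕ) → Set
Tuple d = ∀ i → Fin (d i)

ι : ∀ {k} (d : Fin k → ℕ) → Tuple d → Fin (prod d)
ι {zero}  d c = zero
ι {suc k} d c = combine (c zero) (ι (d ∘ suc) (c ∘ suc))

-- its inverse ι_d⁻¹ (remQuot is the inverse of combine)
ι⁻¹ : ∀ {k} (d : Fin k → ℕ) → Fin (prod d) → Tuple d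
ι⁻¹ {zero}  d x ()
ι⁻¹ {suc k} d x zero    = proj₁ (remQuot {d zero} (prod (d ∘ suc)) x)
ι⁻¹ {suc k} d x (suc i) = ι⁻¹ (d ∘ suc) (proj₂ (remQuot {d zero} (prod (d ∘ suc)) x)) i

record GenArrow (n m : ℕ) : Set₁ where
  field
    rel    : Fin (n + m) → Fin (n + m) → Set
    refl'  : ∀ x → rel x x
    sym'   : ∀ {x y} → rel x y → rel y x
    trans' : ∀ {x y z} → rel x y → rel y z → rel x z
open GenArrow public

-- J (f^op) for f : m → n : classes {i} ∪ {n + j | f j = i}
J : ∀ {n m} → (Fin m → Fin n) → GenArrow n m
J {n} f = record
  { rel = λ x y → cls x ≡ cls y
  ; refl' = λ _ → Eq.refl
  ; sym' = Eq.sym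
  ; trans' = Eq.trans }
  where
    import Relation.Binary.PropositionalEquality as Eq
    cls : _ → Fin _
    cls = [ id , f ] ∘ splitAt n

seqAB : ∀ {n m} → (Fin n → ℕ) → (Fin m → ℕ) → Fin (n + m) → ℕ
seqAB {n} a b = [ a , b ] ∘ splitAt n

Appropriate : ∀ {n m} → GenArrow n m → (Fin n → ℕ) → (Fin m → ℕ) → Set
Appropriate R a b = ∀ x y → rel R x y → seqAB a b x ≡ seqAB a b y

-- (i , j) ∈ F_ab(R); entries of c compared as natural numbers
F : ∀ {n m} → GenArrow n m → (a : Fin n → ℕ) (b : Fin m → ℕ) →
    Fin (prod a) → Fin (prod b) → Set
F {n} R a b i j = ∀ x y → rel R x y → c x ≡ c y
  where
    c : _ → ℕ
    c = [ (λ p → toℕ (ι⁻¹ a i p)) , (λ q → toℕ (ι⁻¹ b j q)) ] ∘ splitAt n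

module Submission where

-- The relation R = J f identifies a source position p with
-- every target position q such that f q = p, and nothing else.  Hence a
-- labelling of the n + m positions respects R exactly when the label of
-- every target position q equals the label of the source position f q
-- (respects-J⇒ / ⇒respects-J).  Applied to the arities, appropriateness
-- gives b q ≡ a (f q); applied to the coordinates of a pair (i , j), the
-- condition F (J f) a b i j says that coordinate q of ι⁻¹ b j equals
-- coordinate f q of ι⁻¹ a i.  So the tuple of coordinates of the related j
-- is forced, and since ι is a bijection with inverse ι⁻¹ (ι⁻¹-ι, ι-ι⁻¹),
-- there is exactly one such j, namely ι b of that tuple.

open import Defs
open import Data.Nat using (ℕ; _+_; _≤_; zero; suc)
open import Data.Fin using (Fin; zero; suc; toℕ; combine; remQuot; splitAt; cast; _↑ˡ_; _↑ʳ_)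
open import Data.Fin.Properties using (remQuot-combine; combine-remQuot; splitAt-↑ˡ; splitAt-↑ʳ; toℕ-cast; toℕ-injective)
open import Data.Sum using (inj₁; inj₂; [_,_])
open import Data.Product using (∃!; _,_; proj₁; proj₂)
open import Function using (_∘_; id)
open import Relation.Binary.PropositionalEquality using (_≡_; refl; sym; trans; cong; cong₂; module ≡-Reasoning)

ι⁻¹-ι : ∀ {k} (d : Fin k → ℕ) (c : Tuple d) i → ι⁻¹ d (ι d c) i ≡ c i
ι⁻¹-ι {suc k} d c i = step i
  where
    split≡ : remQuot (prod (d ∘ suc)) (ι d c) ≡ (c zero , ι (d ∘ suc) (c ∘ suc))
    split≡ = remQuot-combine (c zero) (ι (d ∘ suc) (c ∘ suc))
    step : ∀ i → ι⁻¹ d (ι d c) i ≡ c i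
    step zero    = cong proj₁ split≡
    step (suc i) = trans (cong (λ x → ι⁻¹ (d ∘ suc) x i) (cong proj₂ split≡))
                         (ι⁻¹-ι (d ∘ suc) (c ∘ suc) i)

ι-ι⁻¹ : ∀ {k} (d : Fin k → ℕ) x → ι d (ι⁻¹ d x) ≡ x
ι-ι⁻¹ {zero}  d zero = refl
ι-ι⁻¹ {suc k} d x =
  trans (cong (combine (proj₁ qr)) (ι-ι⁻¹ (d ∘ suc) (proj₂ qr)))
        (combine-remQuot {d zero} (prod (d ∘ suc)) x)
  where qr = remQuot {d zero} (prod (d ∘ suc)) x

-- ι only depends on the coordinates pointwise (we have no function
-- extensionality, so this is stated explicitly).
ι-cong : ∀ {k} (d : Fin k → ℕ) {c c' : Tuple d} → (∀ i → c i ≡ c' i) → ι d c ≡ ι d c'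
ι-cong {zero}  d e = refl
ι-cong {suc k} d e = cong₂ combine (e zero) (ι-cong (d ∘ suc) (e ∘ suc))

ι⁻¹-injective : ∀ {k} (d : Fin k → ℕ) {x y} → (∀ i → ι⁻¹ d x i ≡ ι⁻¹ d y i) → x ≡ y
ι⁻¹-injective d {x} {y} e = begin
  x                 ≡⟨ ι-ι⁻¹ d x ⟨
  ι d (ι⁻¹ d x)     ≡⟨ ι-cong d e ⟩
  ι d (ι⁻¹ d y)     ≡⟨ ι-ι⁻¹ d y ⟩
  y                 ∎
  where open ≡-Reasoning

-- A labelling of the positions of n + m respects a relation of Gen.
-- Both Appropriate and F are instances of this notion.
Respects : ∀ {n m} {A : Set} → GenArrow n m → (Fin (n + m) → A) → Set
Respects R c = ∀ x y → rel R x y → c x ≡ c y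

label-↑ˡ : ∀ {n m} {A : Set} (g : Fin n → A) (h : Fin m → A) p →
           [ g , h ] (splitAt n (p ↑ˡ m)) ≡ g p
label-↑ˡ {n} {m} g h p = cong [ g , h ] (splitAt-↑ˡ n p m)

label-↑ʳ : ∀ {n m} {A : Set} (g : Fin n → A) (h : Fin m → A) q →
           [ g , h ] (splitAt n (n ↑ʳ q)) ≡ h q
label-↑ʳ {n} {m} g h q = cong [ g , h ] (splitAt-↑ʳ n m q)

module _ {n m} (f : Fin m → Fin n) {A : Set} (g : Fin n → A) (h : Fin m → A) where

  respects-J⇒ : Respects (J f) ([ g , h ] ∘ splitAt n) → ∀ q → h q ≡ g (f q)
  respects-J⇒ resp q = begin
    h q                              ≡⟨ label-↑ʳ g h q ⟨
    [ g , h ] (splitAt n (n ↑ʳ q))   ≡⟨ resp (n ↑ʳ q) (f q ↑ˡ m) linked ⟩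
    [ g , h ] (splitAt n (f q ↑ˡ m)) ≡⟨ label-↑ˡ g h (f q) ⟩
    g (f q)                          ∎
    where
      open ≡-Reasoning
      linked : rel (J f) (n ↑ʳ q) (f q ↑ˡ m)
      linked = trans (label-↑ʳ id f q) (sym (label-↑ˡ id f (f q)))

  ⇒respects-J : (∀ q → h q ≡ g (f q)) → Respects (J f) ([ g , h ] ∘ splitAt n)
  ⇒respects-J e x y x~y = trans (factor x) (trans (cong g x~y) (sym (factor y)))
    where
      -- the labelling factors through the class map [ id , f ] ∘ splitAt n
      factor : ∀ x → [ g , h ] (splitAt n x) ≡ g ([ id , f ] (splitAt n x))
      factor x with splitAt n x
      ... | inj₁ p = refl
      ... | inj₂ q = e q

lemma4 : ∀ {n m} (f : Fin m → Fin n) (a : Fin n → ℕ) (b : Fin m → ℕ) →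
         (∀ i → 2 ≤ a i) → (∀ j → 2 ≤ b j) →
         Appropriate (J f) a b →
         ∀ i → ∃! _≡_ (λ j → F (J f) a b i j)
lemma4 f a b _ _ appropriate i = ι b s , related , unique
  where
    t : Tuple a
    t = ι⁻¹ a i
    arity : ∀ q → b q ≡ a (f q)
    arity = respects-J⇒ f a b appropriate
    s : Tuple b
    s q = cast (sym (arity q)) (t (f q))
    copies : ∀ q → toℕ (s q) ≡ toℕ (t (f q))
    copies q = toℕ-cast (sym (arity q)) (t (f q))
    related : F (J f) a b i (ι b s)
    related = ⇒respects-J f (toℕ ∘ t) (toℕ ∘ ι⁻¹ b (ι b s))
                (λ q → trans (cong toℕ (ι⁻¹-ι b s q)) (copies q))
    unique : ∀ {j} → F (J f) a b i j → ι b s ≡ j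
    unique {j} Fij = ι⁻¹-injective b λ q →
      trans (ι⁻¹-ι b s q) (toℕ-injective (trans (copies q) (sym (coordinate q))))
      where
        coordinate : ∀ q → toℕ (ι⁻¹ b j q) ≡ toℕ (t (f q))
        coordinate = respects-J⇒ f (toℕ ∘ t) (toℕ ∘ ι⁻¹ b j) Fij
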